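{- Let $P, Q$ be two microCCS processes. Then $P\sim Q$ if and only if $\mathrm{nf}(P)\equiv \mathrm{nf}(Q)$, where $\mathrm{nf}(R)$ denotes the normal form of $R$ with respect to the distribution rewriting relation $\rightarrow_d$.
   Context: Fix an infinite set of names $a,b,\dots$. MicroCCS processes are given by $\eta ::= a \mid \overline{a}$ and $P ::= \mathbf{0} \mid \eta.P \mid P\,|\,Q$, with $\overline{\overline{a}}=a$. Structural congruence $\equiv$ is the smallest congruence satisfying $P|Q\equiv Q|P$, $P|(Q|R)\equiv (P|Q)|R$, $P|\mathbf{0}\equiv P$. The labelled transition system has actions $\mu ::= \eta \mid \tau$ and rules: $\eta.P\xrightarrow{\eta}P$; if $P\xrightarrow{\eta}P'$ and $Q\xrightarrow{\overline{\eta}}Q'$ then $P|Q\xrightarrow{\tau}P'|Q'$; if $P\xrightarrow{\mu}P'$ then $P|Q\xrightarrow{\mu}P'|Q$ and $Q|P\xrightarrow{\mu}Q|P'$. A bisimulation is a symmetric relation $\mathcal R$ such that $P\mathcal R Q$ and $P\xrightarrow{\mu}P'$ imply $Q\xrightarrow{\mu}Q'$ with $P'\mathcal R Q'$ for some $Q'$; bisimilarity $\sim$ is the union of all bisimulations. Write $R^k$ for the parallel composition of $k$ copies of $R$. The relation $P\rightarrow_d P'$ holds when there are $P_1,P_2$ with $P\equiv P_1$, $P_2\equiv P'$, and $P_2$ is obtained from $P_1$ by replacing a subterm of the form $\eta.(R\,|\,(\eta.R)^k)$, for some $k\geq 1$, by $(\eta.R)^{k+1}$. The relation $\rightarrow_d$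 is strongly normalising and confluent, so every $P$ has a normal form $\mathrm{nf}(P)$, unique up to $\equiv$. -}

module Defs where

open import Data.Nat using (ℕ; zero; suc; _≥_)
open import Data.Product using (Σ; ∃; _×_; _,_)
open import Relation.Binary.PropositionalEquality using (_≡_)
open import Relation.Nullary using (¬_)
open import Level using (Level)

Name : Set
Name = ℕ

data Prefix : Set where
  pos : Name → Prefix
  neg : Name → Prefix

bar : Prefix → Prefix
bar (pos a) = neg a
bar (neg a) = pos a

infixr 6 _∣_
infixr 7 _·_
data Proc : Set where
  𝟘   : Proc
  _·_ : Prefix → Proc → Proc
  _∣_ : Proc → Proc → Proc

pow : Proc → ℕ → Proc
pow R zero = 𝟘
pow R (suc zero) = R
pow R (suc (suc k)) = R ∣ pow R (suc k)

infix 4 _≡s_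
data _≡s_ : Proc → Proc → Set where
  s-refl  : ∀ {P} → P ≡s P
  s-sym   : ∀ {P Q} → P ≡s Q → Q ≡s P
  s-trans : ∀ {P Q R} → P ≡s Q → Q ≡s R → P ≡s R
  s-pre   : ∀ {η P Q} → P ≡s Q → η · P ≡s η · Q
  s-par   : ∀ {P P' Q Q'} → P ≡s P' → Q ≡s Q' → P ∣ Q ≡s P' ∣ Q'
  s-comm  : ∀ {P Q} → P ∣ Q ≡s Q ∣ P
  s-assoc : ∀ {P Q R} → P ∣ (Q ∣ R) ≡s (P ∣ Q) ∣ R
  s-unit  : ∀ {P} → P ∣ 𝟘 ≡s P

data Act : Set where
  vis : Prefix → Act
  τ   : Act

data _—[_]→_ : Proc → Act → Proc → Set where
  t-pre  : ∀ {η P} → (η · P) —[ vis η ]→ P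
  t-com  : ∀ {η P P' Q Q'} → P —[ vis η ]→ P' → Q —[ vis (bar η) ]→ Q' →
           (P ∣ Q) —[ τ ]→ (P' ∣ Q')
  t-parL : ∀ {μ P P' Q} → P —[ μ ]→ P' → (P ∣ Q) —[ μ ]→ (P' ∣ Q)
  t-parR : ∀ {μ P P' Q} → P —[ μ ]→ P' → (Q ∣ P) —[ μ ]→ (Q ∣ P')

IsBisimulation : (Proc → Proc → Set) → Set
IsBisimulation ℛ =
  (∀ {P Q} → ℛ P Q → ℛ Q P) ×
  (∀ {P Q μ P'} → ℛ P Q → P —[ μ ]→ P' → ∃ λ Q' → (Q —[ μ ]→ Q') × ℛ P' Q')

infix 4 _∼_
_∼_ : Proc → Proc → Set₁
P ∼ Q = Σ (Proc → Proc → Set) λ ℛ → IsBisimulation ℛ × ℛ P Q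

data DStep : Proc → Proc → Set where
  d-base : ∀ {η R k} → k ≥ 1 → DStep (η · (R ∣ pow (η · R) k)) (pow (η · R) (suc k))
  d-pre  : ∀ {η P P'} → DStep P P' → DStep (η · P) (η · P')
  d-parL : ∀ {P P' Q} → DStep P P' → DStep (P ∣ Q) (P' ∣ Q)
  d-parR : ∀ {P P' Q} → DStep P P' → DStep (Q ∣ P) (Q ∣ P')

infix 4 _→d_
_→d_ : Proc → Proc → Set
P →d P' = ∃ λ P₁ → ∃ λ P₂ → (P ≡s P₁) × DStep P₁ P₂ × (P₂ ≡s P')

data _→d*_ : Proc → Proc → Set where
  d-done : ∀ {P} → P →d* P
  d-step : ∀ {P P' P''} → P →d P' → P' →d* P'' → P →d* P''

Normal : Proc → Set
Normal P = ∀ P' → ¬ (P →d P')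

IsNF : Proc → Proc → Set
IsNF P N = (P →d* N) × Normal N

-- The congruence ≈ generated by ≡s and the distribution law is a bisimulation, and every
-- process is ≈-related to its normal form; this gives one direction. Conversely, up to ≡s a
-- process is a multiset of prefixed components η.C, and a visible transition fires one of
-- them, replacing it by the components of C. Two bisimilar redex-free processes have the
-- same multiset, by induction on size: every component x on one side has a twin y on the
-- other whose firing leaves the same multiset. Take c = η.C of maximal size; it occurs in no
-- body. If its twin c′ = η.C′ differs from c, counting occurrences of c forces the two
-- processes to be c and c′^(k+1) with C ≡ C′ | c′^k; then either k = 0 and c = c′, or c is
-- a distribution redex. So c is its own twin and can be cancelled.

{-# OPTIONS --safe #-}
module Submission where

open import Defs
open import Function.Bundles using (_⇔_; mk⇔)
open import Function.Base using (_∘_)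
open import Data.Empty using (⊥-elim)
open import Data.Nat using (ℕ; zero; suc; _+_; _≤_; _<_; s≤s; z≤n)
import Data.Nat.Properties as ℕ
open import Data.List using (List; []; _∷_; [_]; _++_; length; replicate; filter)
import Data.List.Properties as List
open import Data.List.Relation.Unary.Any using (Any; here; there)
import Data.List.Relation.Unary.Any.Properties as Any
import Data.List.Relation.Unary.All as All
open import Data.List.Relation.Unary.All.Properties using (¬Any⇒All¬)
open import Data.List.Membership.Propositional using (_∈_; _∉_; lose)
open import Data.List.Membership.Propositional.Properties using (∈-++⁻; ∈-++⁺ˡ; ∈-++⁺ʳ)
open import Data.List.Relation.Binary.Permutation.Propositional
  using (_↭_; ↭-refl; ↭-sym; ↭-trans; ↭-reflexive; prep; swap; ↭⇒↭ₛ; module PermutationReasoning)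
import Data.List.Relation.Binary.Permutation.Propositional.Properties as ↭
import Data.List.Relation.Binary.Permutation.Homogeneous as Homogeneous
import Data.List.Relation.Binary.Pointwise as Pointwise
import Data.List.Relation.Binary.Lex.NonStrict as Lex
import Data.List.Relation.Unary.Sorted.TotalOrder.Properties as Sorted
open import Data.Product using (∃; ∃₂; _×_; _,_; proj₁; proj₂)
open import Data.List.Extrema ℕ.≤-totalOrder using (argmax; argmax-sel; f[⊥]≤f[argmax]; f[xs]≤f[argmax])
open import Induction.WellFounded using (Acc; acc)
open import Data.Nat.Induction using (<-wellFounded)
open import Data.Sum using (_⊎_; inj₁; inj₂; [_,_]′)
open import Relation.Nullary using (¬_; yes; no)
open import Relation.Nullary.Decidable using (map′)
open import Relation.Binary.Bundles using (DecTotalOrder)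
open import Relation.Binary.Definitions using (DecidableEquality)
import Relation.Binary.Construct.On as On
open import Relation.Binary.PropositionalEquality
  using (_≡_; _≢_; ≢-sym; refl; sym; trans; cong; cong₂; subst; module ≡-Reasoning)

-- Canonical forms for structural congruence

Component : Set
Component = Prefix × Proc

encode : Proc → List ℕ
encode 𝟘           = 0 ∷ []
encode (pos a · P) = 1 ∷ a ∷ encode P
encode (neg a · P) = 2 ∷ a ∷ encode P
encode (P ∣ Q)     = 3 ∷ encode P ++ encode Q

encode-++-injective : ∀ P Q {r s} → encode P ++ r ≡ encode Q ++ s → P ≡ Q × r ≡ s
encode-++-injective 𝟘 𝟘 e = refl , List.∷-injectiveʳ e
encode-++-injective (pos a · P) (pos b · Q) e
  with refl , e′ ← List.∷-injective (List.∷-injectiveʳ e)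
  with refl , refl ← encode-++-injective P Q e′ = refl , refl
encode-++-injective (neg a · P) (neg b · Q) e
  with refl , e′ ← List.∷-injective (List.∷-injectiveʳ e)
  with refl , refl ← encode-++-injective P Q e′ = refl , refl
encode-++-injective (P ∣ P′) (Q ∣ Q′) {r} {s} e
  with refl , e′ ← encode-++-injective P Q
         (trans (sym (List.++-assoc (encode P) _ r))
           (trans (List.∷-injectiveʳ e) (List.++-assoc (encode Q) _ s)))
  with refl , refl ← encode-++-injective P′ Q′ e′ = refl , refl
encode-++-injective 𝟘 (pos _ · _) ()
encode-++-injective 𝟘 (neg _ · _) ()
encode-++-injective 𝟘 (_ ∣ _) ()
encode-++-injective (pos _ · _) 𝟘 ()
encode-++-injective (pos _ · _) (neg _ · _) ()
encode-++-injective (pos _ · _) (_ ∣ _) ()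
encode-++-injective (neg _ · _) 𝟘 ()
encode-++-injective (neg _ · _) (pos _ · _) ()
encode-++-injective (neg _ · _) (_ ∣ _) ()
encode-++-injective (_ ∣ _) 𝟘 ()
encode-++-injective (_ ∣ _) (pos _ · _) ()
encode-++-injective (_ ∣ _) (neg _ · _) ()

encode-component : Component → List ℕ
encode-component (η , C) = encode (η · C)

encode-injective : ∀ {P Q} → encode P ≡ encode Q → P ≡ Q
encode-injective {P} {Q} e =
  proj₁ (encode-++-injective P Q (trans (List.++-identityʳ _) (trans e (sym (List.++-identityʳ _)))))

encode-component-injective : ∀ {c d} → encode-component c ≡ encode-component d → c ≡ d
encode-component-injective {η , C} {θ , D} e with refl ← encode-injective {η · C} {θ · D} e = refl

_≟_ : DecidableEquality Component
c ≟ d = map′ encode-component-injective (cong encode-component)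
  (List.≡-dec ℕ._≟_ (encode-component c) (encode-component d))

componentOrder : DecTotalOrder _ _ _
componentOrder = On.decTotalOrder (Lex.≤-decTotalOrder ℕ.≤-decTotalOrder) encode-component

open import Data.List.Sort componentOrder using (sort; sort-↭; sort-↗)

sort-resp-↭ : ∀ {L M} → L ↭ M → sort L ≡ sort M
sort-resp-↭ {L} {M} p =
  Pointwise.Pointwise-≡⇒≡ (Pointwise.map (encode-component-injective ∘ Pointwise.Pointwise-≡⇒≡)
    (Sorted.↗↭↗⇒≋ (DecTotalOrder.totalOrder componentOrder) (sort-↗ L) (sort-↗ M)
      (Homogeneous.map (DecTotalOrder.Eq.reflexive componentOrder)
        (↭⇒↭ₛ (↭-trans (sort-↭ L) (↭-trans p (↭-sym (sort-↭ M))))))))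

s-swap : ∀ {P Q R} → P ∣ (Q ∣ R) ≡s Q ∣ (P ∣ R)
s-swap = s-trans s-assoc (s-trans (s-par s-comm s-refl) (s-sym s-assoc))

build : List Component → Proc
build []             = 𝟘
build ((η , C) ∷ cs) = η · C ∣ build cs

-- Bodies are kept in canonical form, so that ≡s on processes becomes ↭ on components
-- (flatten-resp-≡s, ↭⇒≡s).
canon   : Proc → Proc
flatten : Proc → List Component

canon P = build (sort (flatten P))

flatten 𝟘       = []
flatten (η · P) = [ η , canon P ]
flatten (P ∣ Q) = flatten P ++ flatten Q

body : Component → List Component
body (_ , C) = flatten C

build-++ : ∀ L M → build (L ++ M) ≡s build L ∣ build M
build-++ []             M = s-sym (s-trans s-comm s-unit)
build-++ ((η , C) ∷ L) M = s-trans (s-par s-refl (build-++ L M)) s-assoc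

build-resp-↭ : ∀ {L M} → L ↭ M → build L ≡s build M
build-resp-↭ _↭_.refl                        = s-refl
build-resp-↭ (prep (η , C) p)                = s-par s-refl (build-resp-↭ p)
build-resp-↭ (swap (η , C) (θ , D) p)        =
  s-trans (s-par s-refl (s-par s-refl (build-resp-↭ p))) s-swap
build-resp-↭ (_↭_.trans p q)                 = s-trans (build-resp-↭ p) (build-resp-↭ q)

≡s-build-flatten : ∀ P → P ≡s build (flatten P)
≡s-canon         : ∀ P → P ≡s canon P

≡s-build-flatten 𝟘       = s-refl
≡s-build-flatten (η · P) = s-sym (s-trans s-unit (s-pre (s-sym (≡s-canon P))))
≡s-build-flatten (P ∣ Q) =
  s-trans (s-par (≡s-build-flatten P) (≡s-build-flatten Q)) (s-sym (build-++ (flatten P) (flatten Q)))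

≡s-canon P = s-trans (≡s-build-flatten P) (build-resp-↭ (↭-sym (sort-↭ (flatten P))))

flatten-resp-≡s : ∀ {P Q} → P ≡s Q → flatten P ↭ flatten Q
canon-resp-≡s   : ∀ {P Q} → P ≡s Q → canon P ≡ canon Q

flatten-resp-≡s s-refl                = ↭-refl
flatten-resp-≡s (s-sym p)             = ↭-sym (flatten-resp-≡s p)
flatten-resp-≡s (s-trans p q)         = ↭-trans (flatten-resp-≡s p) (flatten-resp-≡s q)
flatten-resp-≡s (s-pre {η} p)         = ↭-reflexive (cong (λ C → [ η , C ]) (canon-resp-≡s p))
flatten-resp-≡s (s-par p q)           = ↭.++⁺ (flatten-resp-≡s p) (flatten-resp-≡s q)
flatten-resp-≡s (s-comm {P} {Q})      = ↭.++-comm (flatten P) (flatten Q)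
flatten-resp-≡s (s-assoc {P} {Q} {R}) =
  ↭-reflexive (sym (List.++-assoc (flatten P) (flatten Q) (flatten R)))
flatten-resp-≡s (s-unit {P})          = ↭-reflexive (List.++-identityʳ (flatten P))

canon-resp-≡s p = cong build (sort-resp-↭ (flatten-resp-≡s p))

↭⇒≡s : ∀ {P Q} → flatten P ↭ flatten Q → P ≡s Q
↭⇒≡s {P} {Q} p = s-trans (≡s-build-flatten P) (s-trans (build-resp-↭ p) (s-sym (≡s-build-flatten Q)))

flatten-canon : ∀ P → flatten (canon P) ↭ flatten P
flatten-canon P = flatten-resp-≡s (s-sym (≡s-canon P))

∈-flatten⇒canonical : ∀ P {c} → c ∈ flatten P → canon (proj₂ c) ≡ proj₂ c
∈-flatten⇒canonical (η · P) (here refl) = canon-resp-≡s (s-sym (≡s-canon P))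
∈-flatten⇒canonical (P ∣ Q) c∈ with ∈-++⁻ (flatten P) c∈
... | inj₁ c∈P = ∈-flatten⇒canonical P c∈P
... | inj₂ c∈Q = ∈-flatten⇒canonical Q c∈Q

flatten-pow : ∀ η R k → flatten (pow (η · R) k) ≡ replicate k (η , canon R)
flatten-pow η R zero          = refl
flatten-pow η R (suc zero)    = refl
flatten-pow η R (suc (suc k)) = cong ((η , canon R) ∷_) (flatten-pow η R (suc k))

size : Proc → ℕ
size 𝟘       = 0
size (η · P) = suc (size P)
size (P ∣ Q) = size P + size Q

size-resp-≡s : ∀ {P Q} → P ≡s Q → size P ≡ size Q
size-resp-≡s s-refl                = refl
size-resp-≡s (s-sym p)             = sym (size-resp-≡s p)
size-resp-≡s (s-trans p q)         = trans (size-resp-≡s p) (size-resp-≡s q)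
size-resp-≡s (s-pre p)             = cong suc (size-resp-≡s p)
size-resp-≡s (s-par p q)           = cong₂ _+_ (size-resp-≡s p) (size-resp-≡s q)
size-resp-≡s (s-comm {P} {Q})      = ℕ.+-comm (size P) (size Q)
size-resp-≡s (s-assoc {P} {Q} {R}) = sym (ℕ.+-assoc (size P) (size Q) (size R))
size-resp-≡s (s-unit {P})          = ℕ.+-identityʳ (size P)

∈-flatten⇒size< : ∀ P {c} → c ∈ flatten P → size (proj₂ c) < size P
∈-flatten⇒size< (η · P) (here refl) = s≤s (ℕ.≤-reflexive (size-resp-≡s (s-sym (≡s-canon P))))
∈-flatten⇒size< (P ∣ Q) c∈ with ∈-++⁻ (flatten P) c∈
... | inj₁ c∈P = ℕ.<-≤-trans (∈-flatten⇒size< P c∈P) (ℕ.m≤m+n (size P) (size Q))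
... | inj₂ c∈Q = ℕ.<-≤-trans (∈-flatten⇒size< Q c∈Q) (ℕ.m≤n+m (size Q) (size P))

∉-body : ∀ {c} d → size (proj₂ d) ≤ size (proj₂ c) → c ∉ body d
∉-body (_ , D) d≤c c∈ = ℕ.<-irrefl refl (ℕ.<-≤-trans (∈-flatten⇒size< D c∈) d≤c)

—→-size : ∀ {P μ P′} → P —[ μ ]→ P′ → size P′ < size P
—→-size t-pre                 = ℕ.≤-refl
—→-size (t-com t u)           = ℕ.+-mono-< (—→-size t) (—→-size u)
—→-size (t-parL {Q = Q} t)    = ℕ.+-monoˡ-< (size Q) (—→-size t)
—→-size (t-parR {Q = Q} t)    = ℕ.+-monoʳ-< (size Q) (—→-size t)

-- Transitions as firing of components

record Fires (P : Proc) (c : Component) (P′ : Proc) : Set where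
  constructor fires
  field
    rest     : List Component
    split    : flatten P ↭ c ∷ rest
    residual : flatten P′ ↭ body c ++ rest

Fires-parL : ∀ {P c P′} Q → Fires P c P′ → Fires (P ∣ Q) c (P′ ∣ Q)
Fires-parL {c = c} Q (fires rest split residual) = fires
  (rest ++ flatten Q) (↭.++⁺ʳ (flatten Q) split)
  (↭-trans (↭.++⁺ʳ (flatten Q) residual) (↭-reflexive (List.++-assoc (body c) rest (flatten Q))))

Fires-parR : ∀ {P c P′} Q → Fires P c P′ → Fires (Q ∣ P) c (Q ∣ P′)
Fires-parR {c = c} Q (fires rest split residual) = fires
  (flatten Q ++ rest) (↭-trans (↭.++⁺ˡ (flatten Q) split) (↭.shift c (flatten Q) rest))
  (↭-trans (↭.++⁺ˡ (flatten Q) residual) (↭.shifts (flatten Q) (body c)))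

Fires-pre : ∀ η P → Fires (η · P) (η , canon P) P
Fires-pre η P =
  fires [] ↭-refl (↭-trans (↭-sym (flatten-canon P)) (↭-reflexive (sym (List.++-identityʳ _))))

—→⇒Fires : ∀ {P η P′} → P —[ vis η ]→ P′ → ∃ λ C → Fires P (η , C) P′
—→⇒Fires (t-pre {η} {P})    = canon P , Fires-pre η P
—→⇒Fires (t-parL {Q = Q} t) = let C , f = —→⇒Fires t in C , Fires-parL Q f
—→⇒Fires (t-parR {Q = Q} t) = let C , f = —→⇒Fires t in C , Fires-parR Q f

∈⇒Fires : ∀ P {c} → c ∈ flatten P → ∃ λ P′ → (P —[ vis (proj₁ c) ]→ P′) × Fires P c P′
∈⇒Fires (η · P) (here refl) = P , t-pre , Fires-pre η P
∈⇒Fires (P ∣ Q) c∈ with ∈-++⁻ (flatten P) c∈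
... | inj₁ c∈P = let P′ , t , f = ∈⇒Fires P c∈P in P′ ∣ Q , t-parL t , Fires-parL Q f
... | inj₂ c∈Q = let Q′ , t , f = ∈⇒Fires Q c∈Q in P ∣ Q′ , t-parR t , Fires-parR P f

IsRedex : Component → Set
IsRedex (η , C) = ∃₂ λ R k → 1 ≤ k × C ≡s R ∣ pow (η · R) k

data Reducible : Component → Set where
  redex  : ∀ {c} → IsRedex c → Reducible c
  nested : ∀ {η C} → Any Reducible (flatten C) → Reducible (η , C)

RedexFree : Proc → Set
RedexFree P = ¬ Any Reducible (flatten P)

→d-pre : ∀ {η P P′} → P →d P′ → η · P →d η · P′
→d-pre (P₁ , P₂ , e₁ , d , e₂) = _ , _ , s-pre e₁ , d-pre d , s-pre e₂

→d-parL : ∀ {P P′} Q → P →d P′ → P ∣ Q →d P′ ∣ Q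
→d-parL Q (P₁ , P₂ , e₁ , d , e₂) = _ , _ , s-par e₁ s-refl , d-parL d , s-par e₂ s-refl

→d-parR : ∀ {P P′} Q → P →d P′ → Q ∣ P →d Q ∣ P′
→d-parR Q (P₁ , P₂ , e₁ , d , e₂) = _ , _ , s-par s-refl e₁ , d-parR d , s-par s-refl e₂

reducible⇒→d : ∀ P → Any Reducible (flatten P) → ∃ (P →d_)
reducible⇒→d (η · P) (here (redex (R , k , k≥1 , e))) =
  _ , _ , _ , s-pre (s-trans (≡s-canon P) e) , d-base k≥1 , s-refl
reducible⇒→d (η · P) (here (nested r)) =
  let P′ , s = reducible⇒→d P (↭.Any-resp-↭ (flatten-canon P) r) in η · P′ , →d-pre s
reducible⇒→d (P ∣ Q) r with Any.++⁻ (flatten P) r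
... | inj₁ rP = let P′ , s = reducible⇒→d P rP in P′ ∣ Q , →d-parL Q s
... | inj₂ rQ = let Q′ , s = reducible⇒→d Q rQ in P ∣ Q′ , →d-parR P s

normal⇒redexFree : ∀ {P} → Normal P → RedexFree P
normal⇒redexFree {P} normal r = let P′ , s = reducible⇒→d P r in normal P′ s

Fires-redexFree : ∀ {P η C P′} → RedexFree P → Fires P (η , C) P′ → RedexFree P′
Fires-redexFree {C = C} free (fires rest split residual) r
  with Any.++⁻ (flatten C) (↭.Any-resp-↭ residual r)
... | inj₁ in-body = free (↭.Any-resp-↭ (↭-sym split) (here (nested in-body)))
... | inj₂ in-rest = free (↭.Any-resp-↭ (↭-sym split) (there in-rest))

-- Soundness of the distribution law

infix 4 _≈_ _≼_

data _≈_ : Proc → Proc → Set where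
  e-refl  : ∀ {P} → P ≈ P
  e-sym   : ∀ {P Q} → P ≈ Q → Q ≈ P
  e-trans : ∀ {P Q R} → P ≈ Q → Q ≈ R → P ≈ R
  e-pre   : ∀ {η P Q} → P ≈ Q → η · P ≈ η · Q
  e-par   : ∀ {P P′ Q Q′} → P ≈ P′ → Q ≈ Q′ → P ∣ Q ≈ P′ ∣ Q′
  e-comm  : ∀ {P Q} → P ∣ Q ≈ Q ∣ P
  e-assoc : ∀ {P Q R} → P ∣ (Q ∣ R) ≈ (P ∣ Q) ∣ R
  e-unit  : ∀ {P} → P ∣ 𝟘 ≈ P
  e-dist  : ∀ {η R k} → 1 ≤ k → η · (R ∣ pow (η · R) k) ≈ pow (η · R) (suc k)

≡s⇒≈ : ∀ {P Q} → P ≡s Q → P ≈ Q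
≡s⇒≈ s-refl        = e-refl
≡s⇒≈ (s-sym p)     = e-sym (≡s⇒≈ p)
≡s⇒≈ (s-trans p q) = e-trans (≡s⇒≈ p) (≡s⇒≈ q)
≡s⇒≈ (s-pre p)     = e-pre (≡s⇒≈ p)
≡s⇒≈ (s-par p q)   = e-par (≡s⇒≈ p) (≡s⇒≈ q)
≡s⇒≈ s-comm        = e-comm
≡s⇒≈ s-assoc       = e-assoc
≡s⇒≈ s-unit        = e-unit

DStep⇒≈ : ∀ {P Q} → DStep P Q → P ≈ Q
DStep⇒≈ (d-base k≥1) = e-dist k≥1
DStep⇒≈ (d-pre d)    = e-pre (DStep⇒≈ d)
DStep⇒≈ (d-parL d)   = e-par (DStep⇒≈ d) e-refl
DStep⇒≈ (d-parR d)   = e-par e-refl (DStep⇒≈ d)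

→d*⇒≈ : ∀ {P Q} → P →d* Q → P ≈ Q
→d*⇒≈ d-done                          = e-refl
→d*⇒≈ (d-step (_ , _ , e₁ , d , e₂) r) =
  e-trans (≡s⇒≈ e₁) (e-trans (DStep⇒≈ d) (e-trans (≡s⇒≈ e₂) (→d*⇒≈ r)))

_≼_ : Proc → Proc → Set
P ≼ Q = ∀ {μ P′} → P —[ μ ]→ P′ → ∃ λ Q′ → (Q —[ μ ]→ Q′) × P′ ≈ Q′

≼-trans : ∀ {P Q R} → P ≼ Q → Q ≼ R → P ≼ R
≼-trans P≼Q Q≼R t =
  let Q′ , u , P′≈Q′ = P≼Q t ; R′ , v , Q′≈R′ = Q≼R u in R′ , v , e-trans P′≈Q′ Q′≈R′

≼-par : ∀ {P P′ Q Q′} → P ≈ P′ → Q ≈ Q′ → P ≼ P′ → Q ≼ Q′ → P ∣ Q ≼ P′ ∣ Q′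
≼-par P≈ Q≈ P≼ Q≼ (t-parL t) = let X , u , r = P≼ t in X ∣ _ , t-parL u , e-par r Q≈
≼-par P≈ Q≈ P≼ Q≼ (t-parR t) = let X , u , r = Q≼ t in _ ∣ X , t-parR u , e-par P≈ r
≼-par P≈ Q≈ P≼ Q≼ (t-com t u) =
  let X , t′ , r = P≼ t ; Y , u′ , s = Q≼ u in X ∣ Y , t-com t′ u′ , e-par r s

bar-involutive : ∀ η → bar (bar η) ≡ η
bar-involutive (pos a) = refl
bar-involutive (neg a) = refl

vis-bar-≢ : ∀ η → vis (bar η) ≢ vis η
vis-bar-≢ (pos a) ()
vis-bar-≢ (neg a) ()

≼-comm : ∀ {P Q} → P ∣ Q ≼ Q ∣ P
≼-comm (t-parL t)        = _ , t-parR t , e-comm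
≼-comm (t-parR t)        = _ , t-parL t , e-comm
≼-comm (t-com {η} t u)   =
  _ , t-com u (subst (λ θ → _ —[ vis θ ]→ _) (sym (bar-involutive η)) t) , e-comm

≼-assoc : ∀ {P Q R} → P ∣ (Q ∣ R) ≼ (P ∣ Q) ∣ R
≼-assoc (t-parL t)          = _ , t-parL (t-parL t) , e-assoc
≼-assoc (t-parR (t-parL t)) = _ , t-parL (t-parR t) , e-assoc
≼-assoc (t-parR (t-parR t)) = _ , t-parR t , e-assoc
≼-assoc (t-parR (t-com t u)) = _ , t-com (t-parR t) u , e-assoc
≼-assoc (t-com t (t-parL u)) = _ , t-parL (t-com t u) , e-assoc
≼-assoc (t-com t (t-parR u)) = _ , t-com (t-parL t) u , e-assoc

≼-assoc˘ : ∀ {P Q R} → (P ∣ Q) ∣ R ≼ P ∣ (Q ∣ R)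
≼-assoc˘ (t-parL (t-parL t))  = _ , t-parL t , e-sym e-assoc
≼-assoc˘ (t-parL (t-parR t))  = _ , t-parR (t-parL t) , e-sym e-assoc
≼-assoc˘ (t-parL (t-com t u)) = _ , t-com t (t-parL u) , e-sym e-assoc
≼-assoc˘ (t-parR t)           = _ , t-parR (t-parR t) , e-sym e-assoc
≼-assoc˘ (t-com (t-parL t) u) = _ , t-com t (t-parR u) , e-sym e-assoc
≼-assoc˘ (t-com (t-parR t) u) = _ , t-parR (t-com t u) , e-sym e-assoc

≼-unit : ∀ {P} → P ∣ 𝟘 ≼ P
≼-unit (t-parL t) = _ , t , e-unit

≼-unit˘ : ∀ {P} → P ≼ P ∣ 𝟘
≼-unit˘ t = _ , t-parL t , e-sym e-unit

pow-suc : ∀ {P} m → P ∣ pow P m ≡s pow P (suc m)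
pow-suc zero    = s-unit
pow-suc (suc m) = s-refl

pow-—→ : ∀ {η R μ X} m → pow (η · R) (suc m) —[ μ ]→ X → μ ≡ vis η × X ≡s R ∣ pow (η · R) m
pow-—→ zero    t-pre          = refl , s-sym s-unit
pow-—→ (suc m) (t-parL t-pre) = refl , s-refl
pow-—→ (suc m) (t-parR t) with refl , X≡ ← pow-—→ m t =
  refl , s-trans (s-par s-refl X≡) (s-trans s-swap (s-par s-refl (pow-suc m)))
pow-—→ (suc m) (t-com t-pre u) = ⊥-elim (vis-bar-≢ _ (proj₁ (pow-—→ m u)))

≈⇒≼ : ∀ {P Q} → P ≈ Q → P ≼ Q × Q ≼ P
≈⇒≼ e-refl        = (λ t → _ , t , e-refl) , (λ t → _ , t , e-refl)
≈⇒≼ (e-sym r)     = let P≼Q , Q≼P = ≈⇒≼ r in Q≼P , P≼Q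
≈⇒≼ (e-trans r s) =
  let P≼Q , Q≼P = ≈⇒≼ r ; Q≼R , R≼Q = ≈⇒≼ s in ≼-trans P≼Q Q≼R , ≼-trans R≼Q Q≼P
≈⇒≼ (e-pre r)     = (λ { t-pre → _ , t-pre , r }) , (λ { t-pre → _ , t-pre , e-sym r })
≈⇒≼ (e-par r s)   =
  let P≼ , ≼P = ≈⇒≼ r ; Q≼ , ≼Q = ≈⇒≼ s in ≼-par r s P≼ Q≼ , ≼-par (e-sym r) (e-sym s) ≼P ≼Q
≈⇒≼ e-comm        = ≼-comm , ≼-comm
≈⇒≼ e-assoc       = ≼-assoc , ≼-assoc˘
≈⇒≼ e-unit        = ≼-unit , ≼-unit˘
≈⇒≼ (e-dist {k = suc k} _) = (λ { t-pre → _ , t-parL t-pre , e-refl }) , unfold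
  where
  unfold : pow _ (suc (suc k)) ≼ _
  unfold t with refl , X≡ ← pow-—→ (suc k) t = _ , t-pre , ≡s⇒≈ X≡

≈-isBisimulation : IsBisimulation _≈_
≈-isBisimulation = e-sym , λ r → proj₁ (≈⇒≼ r)

-- Completeness

occ : Component → List Component → ℕ
occ c = length ∘ filter (c ≟_)

occ-↭ : ∀ c {L M} → L ↭ M → occ c L ≡ occ c M
occ-↭ c p = ↭.↭-length (↭.filter-↭ (c ≟_) p)

occ-++ : ∀ c L M → occ c (L ++ M) ≡ occ c L + occ c M
occ-++ c L M = trans (cong length (List.filter-++ (c ≟_) L M)) (List.length-++ (filter (c ≟_) L))

occ-∉ : ∀ {c L} → c ∉ L → occ c L ≡ 0
occ-∉ {c} {L} c∉L = cong length (List.filter-none (c ≟_) (¬Any⇒All¬ L c∉L))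

occ-∈ : ∀ {c L} → c ∈ L → 0 < occ c L
occ-∈ {c} = List.filter-some (c ≟_)

occ-split-≡ : ∀ {c M r} → M ↭ c ∷ r → occ c M ≡ suc (occ c r)
occ-split-≡ {c} p = trans (occ-↭ c p) (cong length (List.filter-accept (c ≟_) refl))

occ-split-≢ : ∀ {c y M r} → c ≢ y → M ↭ y ∷ r → occ c M ≡ occ c r
occ-split-≢ {c} c≢y p = trans (occ-↭ c p) (cong length (List.filter-reject (c ≟_) c≢y))

occ-split-≤ : ∀ {c y M r} → M ↭ y ∷ r → occ c r ≤ occ c M
occ-split-≤ {c} {y} p with c ≟ y
... | yes refl = ℕ.≤-trans (ℕ.n≤1+n _) (ℕ.≤-reflexive (sym (occ-split-≡ p)))
... | no c≢y   = ℕ.≤-reflexive (sym (occ-split-≢ c≢y p))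

occ-body-++ : ∀ {c x} r → c ∉ body x → occ c (body x ++ r) ≡ occ c r
occ-body-++ {c} {x} r c∉ = trans (occ-++ c (body x) r) (cong (_+ occ c r) (occ-∉ c∉))

∉-own-body : ∀ c → c ∉ body c
∉-own-body c = ∉-body c ℕ.≤-refl

-- A component never occurs in its own body, so firing it lowers its own count by one,
-- while firing any other component does not.
fire-injective : ∀ {x y r s} → x ∷ r ↭ y ∷ s → body x ++ r ↭ body y ++ s → x ≡ y
fire-injective {x} {y} {r} {s} split residual with x ≟ y
... | yes x≡y = x≡y
... | no x≢y  = ⊥-elim (ℕ.<-irrefl refl (begin-strict
  occ x r                 <⟨ ℕ.n<1+n _ ⟩
  suc (occ x r)           ≡⟨ sym (occ-split-≡ {x} {x ∷ r} ↭-refl) ⟩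
  occ x (x ∷ r)           ≡⟨ occ-split-≢ x≢y split ⟩
  occ x s                 ≤⟨ ℕ.m≤n+m _ _ ⟩
  occ x (body y) + occ x s ≡⟨ sym (occ-++ x (body y) s) ⟩
  occ x (body y ++ s)     ≡⟨ occ-↭ x (↭-sym residual) ⟩
  occ x (body x ++ r)     ≡⟨ occ-body-++ {x = x} r (∉-own-body x) ⟩
  occ x r                 ∎))
  where open ℕ.≤-Reasoning

-- How bisimilar normal forms match each other's visible transitions, read on components.
record Twins (M₁ : List Component) (x : Component) (M₂ : List Component) (y : Component) : Set where
  constructor twins
  field
    same-prefix : proj₁ x ≡ proj₁ y
    rest₁ rest₂ : List Component
    split₁      : M₁ ↭ x ∷ rest₁
    split₂      : M₂ ↭ y ∷ rest₂
    residual    : body x ++ rest₁ ↭ body y ++ rest₂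

  rest₁⊆ : ∀ {z} → z ∈ rest₁ → z ∈ M₁
  rest₁⊆ z∈ = ↭.∈-resp-↭ (↭-sym split₁) (there z∈)

  rest₂⊆ : ∀ {z} → z ∈ rest₂ → z ∈ M₂
  rest₂⊆ z∈ = ↭.∈-resp-↭ (↭-sym split₂) (there z∈)

  x∈M₁ : x ∈ M₁
  x∈M₁ = ↭.∈-resp-↭ (↭-sym split₁) (here refl)

  y∈M₂ : y ∈ M₂
  y∈M₂ = ↭.∈-resp-↭ (↭-sym split₂) (here refl)

  occ-rest : ∀ {c} → c ∉ body x → c ∉ body y → occ c rest₁ ≡ occ c rest₂
  occ-rest {c} c∉x c∉y =
    trans (sym (occ-body-++ {x = x} rest₁ c∉x))
          (trans (occ-↭ c residual) (occ-body-++ {x = y} rest₂ c∉y))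

Twins-sym : ∀ {M₁ x M₂ y} → Twins M₁ x M₂ y → Twins M₂ y M₁ x
Twins-sym (twins p r₁ r₂ s₁ s₂ res) = twins (sym p) r₂ r₁ s₂ s₁ (↭-sym res)

twins-unique : ∀ {M₁ x x′ M₂ y} → Twins M₁ x M₂ y → Twins M₁ x′ M₂ y → x ≡ x′
twins-unique {y = y} (twins _ r₁ r₂ s₁ s₂ res) (twins _ r₁′ r₂′ s₁′ s₂′ res′) =
  fire-injective (↭-trans (↭-sym s₁) s₁′)
    (↭-trans res (↭-trans (↭.++⁺ˡ (body y) (↭.drop-∷ (↭-trans (↭-sym s₂) s₂′))) (↭-sym res′)))

twins-unique˘ : ∀ {M₁ x M₂ y y′} → Twins M₁ x M₂ y → Twins M₁ x M₂ y′ → y ≡ y′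
twins-unique˘ t t′ = twins-unique (Twins-sym t) (Twins-sym t′)

↭-cancelˡ : ∀ {A : Set} (zs : List A) {xs ys} → zs ++ xs ↭ zs ++ ys → xs ↭ ys
↭-cancelˡ []       p = p
↭-cancelˡ (z ∷ zs) p = ↭-cancelˡ zs (↭.drop-∷ p)

all-≡⇒replicate : ∀ {A : Set} {c : A} L → (∀ {z} → z ∈ L → z ≡ c) → L ≡ replicate (length L) c
all-≡⇒replicate []      _   = refl
all-≡⇒replicate (z ∷ L) all = cong₂ _∷_ (all (here refl)) (all-≡⇒replicate L (all ∘ there))

all-≡-∉⇒[] : ∀ {A : Set} {c : A} L → (∀ {z} → z ∈ L → z ≡ c) → c ∉ L → L ≡ []
all-≡-∉⇒[] []      _   _   = refl
all-≡-∉⇒[] (z ∷ L) all c∉ = ⊥-elim (c∉ (here (sym (all (here refl)))))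

equal-or-redex : ∀ {c c′} k → proj₁ c ≡ proj₁ c′ →
  canon (proj₂ c) ≡ proj₂ c → canon (proj₂ c′) ≡ proj₂ c′ →
  body c ↭ body c′ ++ replicate k c′ → c ≡ c′ ⊎ IsRedex c
equal-or-redex {η , C} {η , C′} zero refl canonical canonical′ p = inj₁ (cong (η ,_) (begin
  C          ≡⟨ sym canonical ⟩
  canon C    ≡⟨ canon-resp-≡s (↭⇒≡s {C} {C′} (↭-trans p (↭-reflexive (List.++-identityʳ _)))) ⟩
  canon C′   ≡⟨ canonical′ ⟩
  C′         ∎))
  where open ≡-Reasoning
equal-or-redex {η , C} {η , C′} (suc k) refl _ canonical′ p = inj₂ (C′ , suc k , s≤s z≤n ,
  ↭⇒≡s (↭-trans p (↭-reflexive (cong (flatten C′ ++_) (sym (begin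
    flatten (pow (η · C′) (suc k)) ≡⟨ flatten-pow η C′ (suc k) ⟩
    replicate (suc k) (η , canon C′) ≡⟨ cong (λ D → replicate (suc k) (η , D)) canonical′ ⟩
    replicate (suc k) (η , C′)       ∎))))))
  where open ≡-Reasoning

module _ (N₁ N₂ : Proc)
  (twin₁ : ∀ {x} → x ∈ flatten N₁ → ∃ (Twins (flatten N₁) x (flatten N₂)))
  (twin₂ : ∀ {y} → y ∈ flatten N₂ → ∃ (Twins (flatten N₂) y (flatten N₁)))
  {c : Component}
  (top₁ : ∀ {x} → x ∈ flatten N₁ → c ∉ body x)
  (top₂ : ∀ {y} → y ∈ flatten N₂ → c ∉ body y)
  where

  private
    M₁ M₂ : List Component
    M₁ = flatten N₁
    M₂ = flatten N₂

  module DistinctTwin {c′} (t : Twins M₁ c M₂ c′) (c′≢c : c′ ≢ c) where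
    open Twins t

    occ-c-surplus : occ c M₁ ≡ suc (occ c M₂)
    occ-c-surplus = begin
      occ c M₁         ≡⟨ occ-split-≡ split₁ ⟩
      suc (occ c rest₁) ≡⟨ cong suc (occ-rest (top₁ x∈M₁) (top₂ y∈M₂)) ⟩
      suc (occ c rest₂) ≡⟨ cong suc (sym (occ-split-≢ (≢-sym c′≢c) split₂)) ⟩
      suc (occ c M₂)   ∎
      where open ≡-Reasoning

    only-c′ : ∀ {y} → y ∈ M₂ → y ≡ c′
    only-c′ y∈ with x , s˘ ← twin₂ y∈ with s ← Twins-sym s˘ | x ≟ c
    ... | yes refl = twins-unique˘ s t
    ... | no x≢c   = ⊥-elim (ℕ.<-irrefl refl (begin-strict
      occ c M₂                  <⟨ ℕ.n<1+n _ ⟩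
      suc (occ c M₂)            ≡⟨ sym occ-c-surplus ⟩
      occ c M₁                  ≡⟨ occ-split-≢ (≢-sym x≢c) (Twins.split₁ s) ⟩
      occ c (Twins.rest₁ s)     ≡⟨ Twins.occ-rest s (top₁ (Twins.x∈M₁ s)) (top₂ y∈) ⟩
      occ c (Twins.rest₂ s)     ≤⟨ occ-split-≤ (Twins.split₂ s) ⟩
      occ c M₂                  ∎))
      where open ℕ.≤-Reasoning

    only-c : ∀ {x} → x ∈ M₁ → x ≡ c
    only-c x∈ with y , s ← twin₁ x∈ with refl ← only-c′ (Twins.y∈M₂ s) = twins-unique s t

    rest₁-empty : rest₁ ≡ []
    rest₁-empty = all-≡-∉⇒[] rest₁ (only-c ∘ rest₁⊆) λ c∈ → ℕ.<-irrefl (sym (begin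
      occ c rest₁ ≡⟨ occ-rest (top₁ x∈M₁) (top₂ y∈M₂) ⟩
      occ c rest₂ ≡⟨ occ-∉ (c′≢c ∘ sym ∘ only-c′ ∘ rest₂⊆) ⟩
      0           ∎)) (occ-∈ c∈)
      where open ≡-Reasoning

    body-c↭c′-copies : body c ↭ body c′ ++ replicate (length rest₂) c′
    body-c↭c′-copies = begin
      body c                          ≡⟨ sym (List.++-identityʳ (body c)) ⟩
      body c ++ []                    ≡⟨ cong (body c ++_) (sym rest₁-empty) ⟩
      body c ++ rest₁                 ↭⟨ residual ⟩
      body c′ ++ rest₂                ≡⟨ cong (body c′ ++_) (all-≡⇒replicate rest₂ (only-c′ ∘ rest₂⊆)) ⟩
      body c′ ++ replicate (length rest₂) c′ ∎
      where open PermutationReasoning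

  twins-↭ : c ∈ M₁ → ¬ IsRedex c → M₁ ↭ M₂
  twins-↭ c∈ irreducible with c′ , t ← twin₁ c∈ with c′ ≟ c
  ... | yes refl = begin
    M₁         ↭⟨ split₁ ⟩
    c ∷ rest₁  ↭⟨ prep c (↭-cancelˡ (body c) residual) ⟩
    c ∷ rest₂  ↭⟨ ↭-sym split₂ ⟩
    M₂         ∎
    where open Twins t
          open PermutationReasoning
  ... | no c′≢c = ⊥-elim ([ c′≢c ∘ sym , irreducible ]′
    (equal-or-redex (length (Twins.rest₂ t)) (Twins.same-prefix t)
      (∈-flatten⇒canonical N₁ c∈) (∈-flatten⇒canonical N₂ (Twins.y∈M₂ t))
      (DistinctTwin.body-c↭c′-copies t c′≢c)))

IsLargestIn : Component → List Component → Set
IsLargestIn c L = c ∈ L × (∀ {x} → x ∈ L → size (proj₂ x) ≤ size (proj₂ c))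

largest : ∀ L → L ≡ [] ⊎ ∃ λ c → IsLargestIn c L
largest []      = inj₁ refl
largest (x ∷ L) = inj₂ (argmax (size ∘ proj₂) x L ,
  [ here , there ]′ (argmax-sel (size ∘ proj₂) x L) ,
  All.lookup (f[⊥]≤f[argmax] {f = size ∘ proj₂} x L All.∷ f[xs]≤f[argmax] x L))

Up-to-≈ : (Proc → Proc → Set) → Proc → Proc → Set
Up-to-≈ ℛ P Q = ∃₂ λ P′ Q′ → P ≈ P′ × ℛ P′ Q′ × Q′ ≈ Q

up-to-≈-isBisimulation : ∀ {ℛ} → IsBisimulation ℛ → IsBisimulation (Up-to-≈ ℛ)
up-to-≈-isBisimulation (ℛ-sym , ℛ-step) =
  (λ (P′ , Q′ , P≈ , r , ≈Q) → Q′ , P′ , e-sym ≈Q , ℛ-sym r , e-sym P≈) ,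
  λ (P′ , Q′ , P≈ , r , ≈Q) t →
    let P″ , t₁ , P≈′ = proj₁ (≈⇒≼ P≈) t
        Q″ , t₂ , r′  = ℛ-step r t₁
        Y  , t₃ , ≈Q′ = proj₁ (≈⇒≼ ≈Q) t₂
    in Y , t₃ , P″ , Q″ , P≈′ , r′ , ≈Q′

module _ {ℬ : Proc → Proc → Set} (bisim : IsBisimulation ℬ) where

  private
    ℬ-sym : ∀ {P Q} → ℬ P Q → ℬ Q P
    ℬ-sym = proj₁ bisim

    ℬ-step : ∀ {P Q μ P′} → ℬ P Q → P —[ μ ]→ P′ → ∃ λ Q′ → (Q —[ μ ]→ Q′) × ℬ P′ Q′
    ℬ-step = proj₂ bisim

  Flat↭Below : Proc → Proc → Set
  Flat↭Below N₁ N₂ = ∀ {X Y} → size X < size N₁ → size Y < size N₂ →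
    ℬ X Y → RedexFree X → RedexFree Y → flatten X ↭ flatten Y

  twin-by-bisimulation : ∀ {N₁ N₂} → Flat↭Below N₁ N₂ → ℬ N₁ N₂ → RedexFree N₁ → RedexFree N₂ →
    ∀ {x} → x ∈ flatten N₁ → ∃ (Twins (flatten N₁) x (flatten N₂))
  twin-by-bisimulation {N₁} below b free₁ free₂ x∈
    with X , t , fx ← ∈⇒Fires N₁ x∈
    with Y , u , bXY ← ℬ-step b t
    with C′ , fy ← —→⇒Fires u
    = _ , twins refl (Fires.rest fx) (Fires.rest fy) (Fires.split fx) (Fires.split fy)
            (↭-trans (↭-sym (Fires.residual fx))
              (↭-trans (below (—→-size t) (—→-size u) bXY
                                (Fires-redexFree free₁ fx) (Fires-redexFree free₂ fy))
                       (Fires.residual fy)))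

  bisimilar-redexFree⇒↭ : ∀ {N₁ N₂} → ℬ N₁ N₂ → RedexFree N₁ → RedexFree N₂ → flatten N₁ ↭ flatten N₂
  bisimilar-redexFree⇒↭ = go (<-wellFounded _)
    where
    go : ∀ {N₁ N₂} → Acc _<_ (size N₁ + size N₂) → ℬ N₁ N₂ → RedexFree N₁ → RedexFree N₂ →
         flatten N₁ ↭ flatten N₂
    go {N₁} {N₂} (acc smaller) b free₁ free₂ = by-largest (largest (flatten N₁ ++ flatten N₂))
      where
      below : Flat↭Below N₁ N₂
      below sX sY = go (smaller (ℕ.+-mono-< sX sY))

      twin₁ : ∀ {x} → x ∈ flatten N₁ → ∃ (Twins (flatten N₁) x (flatten N₂))
      twin₁ = twin-by-bisimulation below b free₁ free₂

      twin₂ : ∀ {y} → y ∈ flatten N₂ → ∃ (Twins (flatten N₂) y (flatten N₁))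
      twin₂ = twin-by-bisimulation (λ sY sX bYX fY fX → ↭-sym (below sX sY (ℬ-sym bYX) fX fY))
                (ℬ-sym b) free₂ free₁

      by-largest : let L = flatten N₁ ++ flatten N₂ in L ≡ [] ⊎ ∃ (λ c → IsLargestIn c L) →
                   flatten N₁ ↭ flatten N₂
      by-largest (inj₁ empty) =
        ↭-reflexive (trans (List.++-conicalˡ _ _ empty) (sym (List.++-conicalʳ _ _ empty)))
      by-largest (inj₂ (c , c∈ , c-max)) =
        [ (λ c∈₁ → twins-↭ N₁ N₂ twin₁ twin₂ top₁ top₂ c∈₁ (free₁ ∘ lose c∈₁ ∘ redex))
        , (λ c∈₂ → ↭-sym (twins-↭ N₂ N₁ twin₂ twin₁ top₂ top₁ c∈₂ (free₂ ∘ lose c∈₂ ∘ redex)))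
        ]′ (∈-++⁻ (flatten N₁) c∈)
        where
        top₁ : ∀ {x} → x ∈ flatten N₁ → c ∉ body x
        top₁ {x} x∈ = ∉-body x (c-max (∈-++⁺ˡ x∈))
        top₂ : ∀ {y} → y ∈ flatten N₂ → c ∉ body y
        top₂ {y} y∈ = ∉-body y (c-max (∈-++⁺ʳ (flatten N₁) y∈))

theorem2p6 : (P Q NP NQ : Proc) → IsNF P NP → IsNF Q NQ → (P ∼ Q) ⇔ (NP ≡s NQ)
theorem2p6 P Q NP NQ (P→NP , normal-NP) (Q→NQ , normal-NQ) = mk⇔ complete sound
  where
  complete : P ∼ Q → NP ≡s NQ
  complete (ℛ , ℛ-bisim , P~Q) = ↭⇒≡s (bisimilar-redexFree⇒↭ (up-to-≈-isBisimulation ℛ-bisim)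
    (P , Q , e-sym (→d*⇒≈ P→NP) , P~Q , →d*⇒≈ Q→NQ)
    (normal⇒redexFree normal-NP) (normal⇒redexFree normal-NQ))

  sound : NP ≡s NQ → P ∼ Q
  sound NP≡NQ = _≈_ , ≈-isBisimulation , e-trans (→d*⇒≈ P→NP) (e-trans (≡s⇒≈ NP≡NQ) (e-sym (→d*⇒≈ Q→NQ)))
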